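{- Let $\Gamma\subseteq\mathrm{For}(\mathcal{L})$, let $\Delta$ be a maximal consistent set of formulae containing $\Gamma$, let $t$ be a term, $x$ a variable, $\varphi$ a formula, and $p\in\mathbb{D}$. If $\sup_x\varphi\mathbin{\dot{ - }}p\in\Delta$, then there is a formula $\varphi'$ such that $\varphi\equiv\varphi'$ and $\varphi'[t/x]\mathbin{\dot{ - }}p\in\Delta$.
   Context: $\mathcal{L}$ is a continuous signature: a nonempty set $\mathcal{R}$ of relation symbols, a set $\mathcal{F}$ of function symbols disjoint from $\mathcal{R}$, arities $n_s<\omega$, and functions $\delta_{s,i}:(0,1]\to(0,1]$ for $i<n_s$; possibly with a distinguished binary relation symbol $d$ (metric). Formulae: $Pt_0\cdots t_{n_P-1}$, $\varphi\mathbin{\dot{ - }}\psi$, $\neg\varphi$, $\tfrac12\varphi$, $\sup_x\varphi$. Abbreviations: $\varphi\wedge\psi:=\varphi\mathbin{\dot{ - }}(\varphi\mathbin{\dot{ - }}\psi)$, $1:=\neg(\varphi\mathbin{\dot{ - }}\varphi)$, $2^{ -n}:=\tfrac12\cdots\tfrac12 1$ ($n$ times); dyadic rationals $\mathbb{D}$ are identified with the closed formulas built from $1$ by $\neg,\mathbin{\dot{ - }},\tfrac12$ denoting them. $\varphi[t/x]$ is free substitution of $t$ for $x$, correct if no variable of $t$ becomes bound. Semantics: a continuous $\mathcal{L}$-pre-structure $\mathfrak{M}$ is a nonempty set $M$ with $f^{\mathfrak{M}}:M^{n_f}\to M$, $P^{\mathfrak{M}}:M^{n_P}\to[0,1]$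 (and, with a metric, $d^{\mathfrak{M}}$ a $[0,1]$-valued pseudometric such that $d^{\mathfrak{M}}(c,e)<\delta_{s,i}(\epsilon)$ implies that changing the $i$-th argument of $f^{\mathfrak{M}}$ from $c$ to $e$ moves the value by $d^{\mathfrak{M}}$-distance $\le\epsilon$, and that of $P^{\mathfrak{M}}$ increases it by at most... more precisely $\max(P^{\mathfrak{M}}(\bar a,c,\bar b)-P^{\mathfrak{M}}(\bar a,e,\bar b),0)\le\epsilon$). Values under an assignment $\sigma$: $\mathfrak{M}(\alpha\mathbin{\dot{ - }}\beta,\sigma)=\max(\mathfrak{M}(\alpha,\sigma)-\mathfrak{M}(\beta,\sigma),0)$, $\neg$: $1-$, $\tfrac12$: half, $\sup_x$: supremum over values of $x$. $\varphi\equiv\psi$ means $\mathfrak{M}(\varphi,\sigma)=\mathfrak{M}(\psi,\sigma)$ for every pre-structure $\mathfrak{M}$ and assignment $\sigma$. Proof system. Axioms: all generalizations $\sup_{x_1}\cdots\sup_{x_n}\chi$ ($n\ge0$) of instances of (A1) $(\varphi\mathbin{\dot{ - }}\psi)\mathbin{\dot{ - }}\varphi$; (A2) $((\chi\mathbin{\dot{ - }}\varphi)\mathbin{\dot{ - }}(\chi\mathbin{\dot{ - }}\psi))\mathbin{\dot{ - }}(\psi\mathbin{\dot{ - }}\varphi)$; (A3) $(\varphi\mathbin{\dot{ - }}(\varphi\mathbin{\dot{ - }}\psi))\mathbin{\dot{ - }}(\psi\mathbin{\dot{ - }}(\psi\mathbin{\dot{ - }}\varphi))$; (A4) $(\varphi\mathbin{\dot{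 - }}\psi)\mathbin{\dot{ - }}(\neg\psi\mathbin{\dot{ - }}\neg\varphi)$; (A5) $\tfrac12\varphi\mathbin{\dot{ - }}(\varphi\mathbin{\dot{ - }}\tfrac12\varphi)$; (A6) $(\varphi\mathbin{\dot{ - }}\tfrac12\varphi)\mathbin{\dot{ - }}\tfrac12\varphi$; (A7) $(\sup_x\psi\mathbin{\dot{ - }}\sup_x\varphi)\mathbin{\dot{ - }}\sup_x(\psi\mathbin{\dot{ - }}\varphi)$; (A8) $\varphi[t/x]\mathbin{\dot{ - }}\sup_x\varphi$ (correct substitution); (A9) $\sup_x\varphi\mathbin{\dot{ - }}\varphi$ ($x$ not free in $\varphi$); with a metric also (A10) $dxx$; (A11) $dxy\mathbin{\dot{ - }}dyx$; (A12) $(dxz\mathbin{\dot{ - }}dxy)\mathbin{\dot{ - }}dyz$; (A13) $(q\mathbin{\dot{ - }}dzw)\wedge(d\,f\bar xz\bar y\,f\bar xw\bar y\mathbin{\dot{ - }}r)$ for $f\in\mathcal{F}$, $|\bar x|=i<n_f$, $\epsilon\in(0,1]$, $r,q\in\mathbb{D}$, $r>\epsilon$, $q<\delta_{f,i}(\epsilon)$; (A14) $(q\mathbin{\dot{ - }}dzw)\wedge((P\bar xz\bar y\mathbin{\dot{ - }}P\bar xw\bar y)\mathbin{\dot{ - }}r)$ analogously for $P\in\mathcal{R}$. Sole rule: modus ponens (from $\varphi$ and $\psi\mathbin{\dot{ - }}\varphi$ infer $\psi$). $\Gamma\vdash_Q\varphi$ iff $\varphi$ has a finite derivation from axioms and members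 of $\Gamma$; inconsistent means proving every formula. A set $\Delta$ is maximal consistent if it is consistent and for all formulae $\varphi,\psi$: (i) if $\Delta\vdash_Q\varphi\mathbin{\dot{ - }}2^{ -n}$ for all $n<\omega$ then $\varphi\in\Delta$; (ii) $\varphi\mathbin{\dot{ - }}\psi\in\Delta$ or $\psi\mathbin{\dot{ - }}\varphi\in\Delta$. -}

module Defs where

open import Level using (0ℓ)
open import Data.Nat using (ℕ; zero; suc) renaming (_≟_ to _≟ℕ_)
open import Data.Fin using (Fin; toℕ)
open import Data.Vec using (Vec; []; _∷_; map; tabulate; _[_]≔_)
open import Data.Vec.Relation.Unary.Any using (Any)
open import Data.Maybe using (Maybe; just; nothing)
open import Data.Product using (Σ; _×_; _,_; proj₁)
open import Data.Sum using (_⊎_; [_,_]′)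
open import Data.Unit using (⊤)
open import Data.Empty using (⊥)
open import Relation.Nullary using (¬_; yes; no)
open import Relation.Binary.PropositionalEquality using (_≡_; _≢_; sym; subst)
open import Algebra.Structures using (IsCommutativeRing)
open import Relation.Binary.Structures using (IsTotalOrder)

-- An abstract model of the real numbers: a Dedekind-complete ordered
-- field (classically unique up to isomorphism, i.e. ℝ).  The sup is an
-- operation on families; its axioms only constrain it on inhabited
-- families that are bounded above.  ½ is redundant (it is 2⁻¹) but is
-- provided explicitly for convenience.

record Reals : Set₁ where
  infixl 6 _+_
  infixl 7 _*_
  infix 4 _≤_
  field
    ℝ            : Set
    _+_ _*_      : ℝ → ℝ → ℝ
    -_           : ℝ → ℝ
    0ℝ 1ℝ        : ℝ
    _≤_          : ℝ → ℝ → Set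
    isCommRing   : IsCommutativeRing _≡_ _+_ _*_ -_ 0ℝ 1ℝ
    0≢1          : 0ℝ ≢ 1ℝ
    inverse      : ∀ x → x ≢ 0ℝ → Σ ℝ (λ y → x * y ≡ 1ℝ)
    isTotalOrder : IsTotalOrder _≡_ _≤_
    +-mono-≤     : ∀ {x y} z → x ≤ y → x + z ≤ y + z
    *-nonneg     : ∀ {x y} → 0ℝ ≤ x → 0ℝ ≤ y → 0ℝ ≤ x * y
    sup          : {A : Set} → (A → ℝ) → ℝ
    sup-ub       : {A : Set} (f : A → ℝ) (b : ℝ) → (∀ a → f a ≤ b) → ∀ a → f a ≤ sup f
    sup-least    : {A : Set} (f : A → ℝ) → A → (b : ℝ) → (∀ a → f a ≤ b) → sup f ≤ b
    ½            : ℝ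
    ½+½≡1        : ½ + ½ ≡ 1ℝ

module RealOps (R : Reals) where
  open Reals R

  infix 4 _<_
  _<_ : ℝ → ℝ → Set
  x < y = (x ≤ y) × (x ≢ y)

  _-_ : ℝ → ℝ → ℝ
  x - y = x + (- y)

  max : ℝ → ℝ → ℝ
  max x y = [ (λ _ → y) , (λ _ → x) ]′ (IsTotalOrder.total isTotalOrder x y)

  _∸ℝ_ : ℝ → ℝ → ℝ
  x ∸ℝ y = max (x - y) 0ℝ

PosUnit : Reals → Set
PosUnit R = Σ ℝ (λ x → (0ℝ < x) × (x ≤ 1ℝ))
  where open Reals R
        open RealOps R

record Signature (R : Reals) : Set₁ where
  field
    Rel Fun      : Set             -- disjoint by construction
    someRel      : Rel
    arR          : Rel → ℕ
    arF          : Fun → ℕ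
    δR           : (P : Rel) → Fin (arR P) → PosUnit R → PosUnit R
    δF           : (f : Fun) → Fin (arF f) → PosUnit R → PosUnit R
    metric       : Maybe Rel
    metric-arity : ∀ {d} → metric ≡ just d → arR d ≡ 2

module Syntax (R : Reals) (L : Signature R) where
  open Reals R
  open RealOps R
  open Signature L

  Var : Set
  Var = ℕ

  data Term : Set where
    var : Var → Term
    app : (f : Fun) → Vec Term (arF f) → Term

  infixl 6 _⊖_
  data Formula : Set where
    rel   : (P : Rel) → Vec Term (arR P) → Formula
    _⊖_   : Formula → Formula → Formula
    neg   : Formula → Formula
    hlf   : Formula → Formula
    supᶠ  : Var → Formula → Formula

  data _∈T_ (x : Var) : Term → Set where
    here  : x ∈T var x
    inApp : ∀ {f ts} → Any (x ∈T_) ts → x ∈T app f ts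

  data FreeIn (x : Var) : Formula → Set where
    inRel : ∀ {P ts} → Any (x ∈T_) ts → FreeIn x (rel P ts)
    inL   : ∀ {φ ψ} → FreeIn x φ → FreeIn x (φ ⊖ ψ)
    inR   : ∀ {φ ψ} → FreeIn x ψ → FreeIn x (φ ⊖ ψ)
    inNeg : ∀ {φ} → FreeIn x φ → FreeIn x (neg φ)
    inHlf : ∀ {φ} → FreeIn x φ → FreeIn x (hlf φ)
    inSup : ∀ {y φ} → x ≢ y → FreeIn x φ → FreeIn x (supᶠ y φ)

  -- free (naive) substitution of t for x
  mutual
    substT : Term → Var → Term → Term
    substT t x (var y) with x ≟ℕ y
    ... | yes _ = t
    ... | no  _ = var y
    substT t x (app f ts) = app f (substTs t x ts)

    substTs : ∀ {n} → Term → Var → Vec Term n → Vec Term n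
    substTs t x []       = []
    substTs t x (s ∷ ss) = substT t x s ∷ substTs t x ss

  _[_/_] : Formula → Term → Var → Formula
  rel P ts [ t / x ] = rel P (substTs t x ts)
  (φ ⊖ ψ)  [ t / x ] = (φ [ t / x ]) ⊖ (ψ [ t / x ])
  neg φ    [ t / x ] = neg (φ [ t / x ])
  hlf φ    [ t / x ] = hlf (φ [ t / x ])
  supᶠ y φ [ t / x ] with x ≟ℕ y
  ... | yes _ = supᶠ y φ
  ... | no  _ = supᶠ y (φ [ t / x ])

  SubstOK : Term → Var → Formula → Set
  SubstOK t x (rel P ts) = ⊤
  SubstOK t x (φ ⊖ ψ)    = SubstOK t x φ × SubstOK t x ψ
  SubstOK t x (neg φ)    = SubstOK t x φ
  SubstOK t x (hlf φ)    = SubstOK t x φ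
  SubstOK t x (supᶠ y φ) = (x ≡ y) ⊎ ((¬ FreeIn x φ) ⊎ ((¬ (y ∈T t)) × SubstOK t x φ))

  infixl 5 _∧_
  _∧_ : Formula → Formula → Formula
  φ ∧ ψ = φ ⊖ (φ ⊖ ψ)

  sups : ℕ → Formula → Formula
  sups zero    φ = φ
  sups (suc n) φ = sups n (supᶠ n φ)

  -- a fixed closed formula θ, and 1 := ¬(θ ∸ θ)
  closedAtom : Formula
  closedAtom = sups (arR someRel) (rel someRel (tabulate (λ i → var (toℕ i))))

  one : Formula
  one = neg (closedAtom ⊖ closedAtom)

  -- 2^{-n}
  pow2 : ℕ → Formula
  pow2 zero    = one
  pow2 (suc n) = hlf (pow2 n)

  data IsDyadic : Formula → Set where
    d-one : IsDyadic one
    d-neg : ∀ {p} → IsDyadic p → IsDyadic (neg p)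
    d-sub : ∀ {p q} → IsDyadic p → IsDyadic q → IsDyadic (p ⊖ q)
    d-hlf : ∀ {p} → IsDyadic p → IsDyadic (hlf p)

  dval : ∀ {p} → IsDyadic p → ℝ
  dval d-one        = 1ℝ
  dval (d-neg p)    = 1ℝ - dval p
  dval (d-sub p q)  = dval p ∸ℝ dval q
  dval (d-hlf p)    = ½ * dval p

  dist : ∀ {d} → metric ≡ just d → Term → Term → Formula
  dist {d} e s t = rel d (subst (Vec Term) (sym (metric-arity e)) (s ∷ t ∷ []))

  -- argument list x̄ z ȳ with |x̄| = i
  args : ∀ {n} → Vec Var n → Fin n → Var → Vec Term n
  args vs i z = map var vs [ i ]≔ var z

  data Axiom : Formula → Set where
    gen : ∀ x {φ} → Axiom φ → Axiom (supᶠ x φ)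
    A1  : ∀ φ ψ → Axiom ((φ ⊖ ψ) ⊖ φ)
    A2  : ∀ φ ψ χ → Axiom (((χ ⊖ φ) ⊖ (χ ⊖ ψ)) ⊖ (ψ ⊖ φ))
    A3  : ∀ φ ψ → Axiom ((φ ⊖ (φ ⊖ ψ)) ⊖ (ψ ⊖ (ψ ⊖ φ)))
    A4  : ∀ φ ψ → Axiom ((φ ⊖ ψ) ⊖ (neg ψ ⊖ neg φ))
    A5  : ∀ φ → Axiom (hlf φ ⊖ (φ ⊖ hlf φ))
    A6  : ∀ φ → Axiom ((φ ⊖ hlf φ) ⊖ hlf φ)
    A7  : ∀ x φ ψ → Axiom ((supᶠ x ψ ⊖ supᶠ x φ) ⊖ supᶠ x (ψ ⊖ φ))
    A8  : ∀ x t φ → SubstOK t x φ → Axiom ((φ [ t / x ]) ⊖ supᶠ x φ)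
    A9  : ∀ x φ → ¬ FreeIn x φ → Axiom (supᶠ x φ ⊖ φ)
    A10 : ∀ {d} (e : metric ≡ just d) x → Axiom (dist e (var x) (var x))
    A11 : ∀ {d} (e : metric ≡ just d) x y →
          Axiom (dist e (var x) (var y) ⊖ dist e (var y) (var x))
    A12 : ∀ {d} (e : metric ≡ just d) x y z →
          Axiom ((dist e (var x) (var z) ⊖ dist e (var x) (var y)) ⊖ dist e (var y) (var z))
    A13 : ∀ {d} (e : metric ≡ just d) (f : Fun) (i : Fin (arF f)) (vs : Vec Var (arF f))
            (z w : Var) (ε : PosUnit R) {q r : Formula} (dq : IsDyadic q) (dr : IsDyadic r) →
          proj₁ ε < dval dr → dval dq < proj₁ (δF f i ε) →
          Axiom ((q ⊖ dist e (var z) (var w))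
                 ∧ (dist e (app f (args vs i z)) (app f (args vs i w)) ⊖ r))
    A14 : ∀ {d} (e : metric ≡ just d) (P : Rel) (i : Fin (arR P)) (vs : Vec Var (arR P))
            (z w : Var) (ε : PosUnit R) {q r : Formula} (dq : IsDyadic q) (dr : IsDyadic r) →
          proj₁ ε < dval dr → dval dq < proj₁ (δR P i ε) →
          Axiom ((q ⊖ dist e (var z) (var w))
                 ∧ ((rel P (args vs i z) ⊖ rel P (args vs i w)) ⊖ r))

  FSet : Set₁
  FSet = Formula → Set

  infix 2 _⊢_
  data _⊢_ (Γ : FSet) : Formula → Set where
    axiom : ∀ {φ} → Axiom φ → Γ ⊢ φ
    hyp   : ∀ {φ} → Γ φ → Γ ⊢ φ
    mp    : ∀ {φ ψ} → Γ ⊢ φ → Γ ⊢ (ψ ⊖ φ) → Γ ⊢ ψ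

  Consistent : FSet → Set
  Consistent Δ = ¬ (∀ φ → Δ ⊢ φ)

  MaximalConsistent : FSet → Set
  MaximalConsistent Δ =
    Consistent Δ
    × (∀ φ → (∀ n → Δ ⊢ (φ ⊖ pow2 n)) → Δ φ)
    × (∀ φ ψ → Δ (φ ⊖ ψ) ⊎ Δ (ψ ⊖ φ))

  record Interp : Set₁ where
    field
      M          : Set
      inhabited  : M
      funI       : (f : Fun) → Vec M (arF f) → M
      relI       : (P : Rel) → Vec M (arR P) → ℝ
      relI-range : ∀ P as → (0ℝ ≤ relI P as) × (relI P as ≤ 1ℝ)

  MetricConds : Interp → Set
  MetricConds I = ∀ {d} (e : metric ≡ just d) →
      (∀ a → dm e a a ≡ 0ℝ)
    × (∀ a b → dm e a b ≡ dm e b a)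
    × (∀ a b c → dm e a c ≤ dm e a b + dm e b c)
    × (∀ (f : Fun) (i : Fin (arF f)) (ε : PosUnit R) as c c' →
         dm e c c' < proj₁ (δF f i ε) →
         dm e (funI f (as [ i ]≔ c)) (funI f (as [ i ]≔ c')) ≤ proj₁ ε)
    × (∀ (P : Rel) (i : Fin (arR P)) (ε : PosUnit R) as c c' →
         dm e c c' < proj₁ (δR P i ε) →
         (relI P (as [ i ]≔ c) ∸ℝ relI P (as [ i ]≔ c')) ≤ proj₁ ε)
    where
      open Interp I
      dm : ∀ {d} → metric ≡ just d → M → M → ℝ
      dm {d} e a b = relI d (subst (Vec M) (sym (metric-arity e)) (a ∷ b ∷ []))

  record PreStructure : Set₁ where
    field
      interp  : Interp
      metricOK : MetricConds interp
    open Interp interp public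

  module _ (𝔐 : PreStructure) where
    open PreStructure 𝔐

    update : (Var → M) → Var → M → Var → M
    update σ x m y with x ≟ℕ y
    ... | yes _ = m
    ... | no  _ = σ y

    mutual
      evalT : (Var → M) → Term → M
      evalT σ (var x)    = σ x
      evalT σ (app f ts) = funI f (evalTs σ ts)

      evalTs : ∀ {n} → (Var → M) → Vec Term n → Vec M n
      evalTs σ []       = []
      evalTs σ (t ∷ ts) = evalT σ t ∷ evalTs σ ts

    eval : (Var → M) → Formula → ℝ
    eval σ (rel P ts) = relI P (evalTs σ ts)
    eval σ (φ ⊖ ψ)    = eval σ φ ∸ℝ eval σ ψ
    eval σ (neg φ)    = 1ℝ - eval σ φ
    eval σ (hlf φ)    = ½ * eval σ φ
    eval σ (supᶠ x φ) = sup (λ (m : M) → eval (update σ x m) φ)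

  SemEquiv : Formula → Formula → Set₁
  SemEquiv φ ψ = (𝔐 : PreStructure) (σ : Var → PreStructure.M 𝔐) →
                 eval 𝔐 σ φ ≡ eval 𝔐 σ ψ

-- Substituting t for x in φ may capture variables of t.  Renaming every bound variable of φ to fresh
-- names k, k+1, … (k above all variables of φ and t) yields φ′ with the same value in every
-- pre-structure and in which t is free for x.  Each renaming step is an α-conversion derivable from
-- (A7)–(A9), and provable ≤ is a congruence for ∸, ¬, ½ and sup, so φ′ ≤ φ is provable.  Hence
-- φ′[t/x] ≤ sup_x φ′ ≤ sup_x φ ≤ p is derivable from Δ, and a maximal consistent set contains
-- everything it derives.

module Submission where

open import Defs
open import Level using (0ℓ)
open import Algebra.Bundles using (Ring)
open import Algebra.Structures using (IsCommutativeRing)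
open import Data.Empty using (⊥; ⊥-elim)
open import Data.Nat using (ℕ; suc) renaming (_≟_ to _≟ℕ_)
open import Data.Product using (Σ; _×_; _,_; proj₁; proj₂)
open import Data.Sum using (inj₁; inj₂)
open import Data.Unit using (⊤; tt)
open import Data.Vec using (Vec; []; _∷_)
open import Data.Vec.Relation.Unary.Any using (Any; here; there)
open import Relation.Binary.PropositionalEquality
  using (_≡_; _≢_; refl; sym; trans; cong; cong₂; subst; subst₂; ≢-sym; module ≡-Reasoning)
open import Relation.Binary.Structures using (IsTotalOrder)
open import Relation.Nullary using (¬_; yes; no)
open import Relation.Unary using (Pred; _⊆_)

module RealFacts (R : Reals) where
  open Reals R
  open RealOps R
  open IsCommutativeRing isCommRing
    using (+-comm; +-assoc; +-identityˡ; +-identityʳ; -‿inverseˡ; -‿inverseʳ; distribˡ; *-identityʳ; isRing)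
  open IsTotalOrder isTotalOrder using (total; antisym) renaming (refl to ≤ℝ-refl; trans to ≤ℝ-trans)

  ring : Ring 0ℓ 0ℓ
  ring = record { isRing = isRing }

  open import Algebra.Properties.Ring ring using (-1*x≈-x; -‿involutive; -‿distribʳ-*)

  InUnit : ℝ → Set
  InUnit x = 0ℝ ≤ x × x ≤ 1ℝ

  +-monoʳ-≤ℝ : ∀ {x y} z → x ≤ y → z + x ≤ z + y
  +-monoʳ-≤ℝ {x} {y} z x≤y = subst₂ _≤_ (+-comm x z) (+-comm y z) (+-mono-≤ z x≤y)

  0≤⇒-≤0 : ∀ {x} → 0ℝ ≤ x → - x ≤ 0ℝ
  0≤⇒-≤0 {x} 0≤x = subst₂ _≤_ (+-identityˡ (- x)) (-‿inverseʳ x) (+-mono-≤ (- x) 0≤x)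

  0≤1 : 0ℝ ≤ 1ℝ
  0≤1 with total 0ℝ 1ℝ
  ... | inj₁ 0≤1 = 0≤1
  ... | inj₂ 1≤0 = subst (0ℝ ≤_) -1*-1≡1 (*-nonneg 0≤-1 0≤-1)
    where
      0≤-1 : 0ℝ ≤ - 1ℝ
      0≤-1 = subst₂ _≤_ (-‿inverseʳ 1ℝ) (+-identityˡ (- 1ℝ)) (+-mono-≤ (- 1ℝ) 1≤0)
      -1*-1≡1 : (- 1ℝ) * (- 1ℝ) ≡ 1ℝ
      -1*-1≡1 = trans (-1*x≈-x (- 1ℝ)) (-‿involutive 1ℝ)

  0≤½ : 0ℝ ≤ ½
  0≤½ with total 0ℝ ½
  ... | inj₁ 0≤½ = 0≤½
  ... | inj₂ ½≤0 = ⊥-elim (0≢1 (antisym 0≤1 1≤0))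
    where
      1≤0 : 1ℝ ≤ 0ℝ
      1≤0 = subst₂ _≤_ ½+½≡1 (+-identityʳ 0ℝ) (≤ℝ-trans (+-mono-≤ ½ ½≤0) (+-monoʳ-≤ℝ 0ℝ ½≤0))

  ½≤1 : ½ ≤ 1ℝ
  ½≤1 = subst₂ _≤_ (+-identityʳ ½) ½+½≡1 (+-monoʳ-≤ℝ ½ 0≤½)

  ∸ℝ-unit : ∀ {x y} → InUnit x → InUnit y → InUnit (x ∸ℝ y)
  ∸ℝ-unit {x} {y} (_ , x≤1) (0≤y , _) with total (x - y) 0ℝ
  ... | inj₁ _ = ≤ℝ-refl , 0≤1
  ... | inj₂ 0≤x-y = 0≤x-y , ≤ℝ-trans (subst (x - y ≤_) (+-identityʳ x) (+-monoʳ-≤ℝ x (0≤⇒-≤0 0≤y))) x≤1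

  1-‿unit : ∀ {x} → InUnit x → InUnit (1ℝ - x)
  1-‿unit {x} (0≤x , x≤1) =
      subst (_≤ 1ℝ - x) (-‿inverseʳ x) (+-mono-≤ (- x) x≤1)
    , subst (1ℝ - x ≤_) (+-identityʳ 1ℝ) (+-monoʳ-≤ℝ 1ℝ (0≤⇒-≤0 0≤x))

  ½*-unit : ∀ {x} → InUnit x → InUnit (½ * x)
  ½*-unit {x} x∈ = *-nonneg 0≤½ (proj₁ x∈) , ≤ℝ-trans ½x≤½ ½≤1
    where
      open ≡-Reasoning
      ½[1-x]≡½-½x : ½ * (1ℝ - x) ≡ ½ - (½ * x)
      ½[1-x]≡½-½x = begin
        ½ * (1ℝ - x)          ≡⟨ distribˡ ½ 1ℝ (- x) ⟩
        ½ * 1ℝ + ½ * (- x)    ≡⟨ cong₂ _+_ (*-identityʳ ½) (sym (-‿distribʳ-* ½ x)) ⟩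
        ½ - (½ * x)             ∎
      ½-½x+½x≡½ : (½ - (½ * x)) + ½ * x ≡ ½
      ½-½x+½x≡½ = begin
        (½ - (½ * x)) + ½ * x   ≡⟨ +-assoc ½ (- (½ * x)) (½ * x) ⟩
        ½ + (- (½ * x) + ½ * x) ≡⟨ cong (½ +_) (-‿inverseˡ (½ * x)) ⟩
        ½ + 0ℝ                ≡⟨ +-identityʳ ½ ⟩
        ½                     ∎
      ½x≤½ : ½ * x ≤ ½
      ½x≤½ = subst₂ _≤_ (+-identityˡ (½ * x)) ½-½x+½x≡½
               (+-mono-≤ (½ * x) (subst (0ℝ ≤_) ½[1-x]≡½-½x (*-nonneg 0≤½ (proj₁ (1-‿unit x∈)))))

  sup-unit : {A : Set} (f : A → ℝ) → A → (∀ a → InUnit (f a)) → InUnit (sup f)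
  sup-unit f a₀ f∈ =
      ≤ℝ-trans (proj₁ (f∈ a₀)) (sup-ub f 1ℝ (λ a → proj₂ (f∈ a)) a₀)
    , sup-least f a₀ 1ℝ (λ a → proj₂ (f∈ a))

  -- Without function extensionality this goes through the sup axioms, which need a bound.
  sup-cong : {A : Set} {f g : A → ℝ} (b : ℝ) → A → (∀ a → f a ≤ b) → (∀ a → f a ≡ g a) → sup f ≡ sup g
  sup-cong {f = f} {g} b a₀ f≤b f≡g = antisym
    (sup-least f a₀ (sup g) (λ a → subst (_≤ sup g) (sym (f≡g a)) (sup-ub g b g≤b a)))
    (sup-least g a₀ (sup f) (λ a → subst (_≤ sup f) (f≡g a) (sup-ub f b f≤b a)))
    where
      g≤b : ∀ a → g a ≤ b
      g≤b a = subst (_≤ b) (f≡g a) (f≤b a)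

module Łukasiewicz (R : Reals) (L : Signature R) (Γ : Syntax.FSet R L) where
  open Syntax R L

  private variable a b c d : Formula

  infixr 4 _⇒_
  _⇒_ : Formula → Formula → Formula
  a ⇒ b = b ⊖ a

  infixl 5 _·_
  _·_ : Γ ⊢ a ⇒ b → Γ ⊢ a → Γ ⊢ b
  a⇒b · a = mp a a⇒b

  infix 3 _≼_ _≋_
  _≼_ : Formula → Formula → Set
  a ≼ b = Γ ⊢ a ⊖ b

  _≋_ : Formula → Formula → Set
  a ≋ b = a ≼ b × b ≼ a

  ⇒-K : Γ ⊢ a ⇒ b ⇒ a
  ⇒-K = axiom (A1 _ _)

  ⇒-syllogism : Γ ⊢ (a ⇒ b) ⇒ (b ⇒ c) ⇒ (a ⇒ c)
  ⇒-syllogism = axiom (A2 _ _ _)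

  ⇒-Ł : Γ ⊢ ((a ⇒ b) ⇒ b) ⇒ ((b ⇒ a) ⇒ a)
  ⇒-Ł = axiom (A3 _ _)

  ⇒-contrapose : Γ ⊢ (neg a ⇒ neg b) ⇒ (b ⇒ a)
  ⇒-contrapose = axiom (A4 _ _)

  ⇒-exchange : Γ ⊢ (a ⇒ b ⇒ c) ⇒ (b ⇒ a ⇒ c)
  ⇒-exchange = ⇒-syllogism · ⇒-syllogism · (⇒-syllogism · (⇒-syllogism · ⇒-K · ⇒-Ł))

  ≼-trans : a ≼ b → b ≼ c → a ≼ c
  ≼-trans a≼b b≼c = ⇒-syllogism · b≼c · a≼b

  -- The discarded premise may be any provable formula; an (A1) instance is used.
  ≼-refl : a ≼ a
  ≼-refl = ⇒-exchange · ⇒-K · ⇒-K {closedAtom} {closedAtom}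

  provable-≼ : Γ ⊢ a → a ≼ b
  provable-≼ ⊢a = ⇒-K · ⊢a

  ⊖-≼ : a ⊖ b ≼ a
  ⊖-≼ = ⇒-K

  ⊖-monoˡ : a ≼ b → a ⊖ c ≼ b ⊖ c
  ⊖-monoˡ a≼b = ⇒-exchange · ⇒-syllogism · a≼b

  ⊖-antitoneʳ : b ≼ c → a ⊖ c ≼ a ⊖ b
  ⊖-antitoneʳ b≼c = ⇒-syllogism · b≼c

  ≼-⊖-provable : Γ ⊢ b → a ≼ a ⊖ b
  ≼-⊖-provable ⊢b = ⇒-exchange · ≼-refl · ⊢b

  ∧-comm : a ∧ b ≼ b ∧ a
  ∧-comm = ⇒-Ł

  ∧-≼ʳ : a ∧ b ≼ b
  ∧-≼ʳ = ≼-trans ∧-comm ⊖-≼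

  ∧-greatest : c ≼ a → c ≼ b → c ≼ a ∧ b
  ∧-greatest c≼a c≼b = ≼-trans (≼-⊖-provable c≼a) (≼-trans ∧-comm (⊖-antitoneʳ (⊖-antitoneʳ c≼b)))

  neg-neg-intro : a ≼ neg (neg a)
  neg-neg-intro = ⇒-exchange · ≼-trans (≼-trans ⇒-contrapose ⇒-contrapose) ⇒-K · ≼-refl {closedAtom}

  neg-neg-elim : neg (neg a) ≼ a
  neg-neg-elim = ⇒-contrapose · neg-neg-intro

  neg-antitone : a ≼ b → neg b ≼ neg a
  neg-antitone a≼b = ⇒-contrapose · ≼-trans neg-neg-elim (≼-trans a≼b neg-neg-intro)

  -- max(a, b) ∸ ((a ∸ b) ∧ (b ∸ a)) still lies above a and b, hence above max(a, b).
  prelinearity : ∀ a b → Γ ⊢ (a ⊖ b) ∧ (b ⊖ a)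
  prelinearity a b = ≼-trans (∧-greatest m≼max ≼-refl) (⊖-antitoneʳ max≼max∸m) · ≼-refl {max}
    where
      m max : Formula
      m = (a ⊖ b) ∧ (b ⊖ a)
      max = neg (neg a ∧ neg b)
      a≼max : a ≼ max
      a≼max = ≼-trans neg-neg-intro (neg-antitone ⊖-≼)
      b≼max : b ≼ max
      b≼max = ≼-trans neg-neg-intro (neg-antitone ∧-≼ʳ)
      m≼max∸b : m ≼ max ⊖ b
      m≼max∸b = ≼-trans ⊖-≼ (⊖-monoˡ a≼max)
      m≼max∸a : m ≼ max ⊖ a
      m≼max∸a = ≼-trans ∧-≼ʳ (⊖-monoˡ b≼max)
      m≼max : m ≼ max
      m≼max = ≼-trans m≼max∸b ⊖-≼
      a≼max∸m : a ≼ max ⊖ m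
      a≼max∸m = ≼-trans (∧-greatest a≼max ≼-refl) (⊖-antitoneʳ m≼max∸a)
      b≼max∸m : b ≼ max ⊖ m
      b≼max∸m = ≼-trans (∧-greatest b≼max ≼-refl) (⊖-antitoneʳ m≼max∸b)
      max≼max∸m : max ≼ max ⊖ m
      max≼max∸m = ≼-trans (neg-antitone (∧-greatest (neg-antitone a≼max∸m) (neg-antitone b≼max∸m))) neg-neg-elim

  ≼-converse⇒provable : a ⊖ b ≼ b ⊖ a → Γ ⊢ a ⊖ b
  ≼-converse⇒provable {a} {b} h = ∧-greatest ≼-refl h · prelinearity a b

  -- ½a ∸ ½b ≤ (b ∸ ½a) ∸ ½b ≤ (b ∸ ½a) ∸ (b ∸ ½b) ≤ ½b ∸ ½a
  hlf-mono : a ≼ b → hlf a ≼ hlf b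
  hlf-mono {a} {b} a≼b = ≼-converse⇒provable
    (≼-trans (⊖-monoˡ (≼-trans (axiom (A5 a)) (⊖-monoˡ a≼b)))
      (≼-trans (⊖-antitoneʳ (axiom (A6 b))) (axiom (A2 _ _ _))))

  ≋-trans : a ≋ b → b ≋ c → a ≋ c
  ≋-trans (a≼b , b≼a) (b≼c , c≼b) = ≼-trans a≼b b≼c , ≼-trans c≼b b≼a

  ⊖-cong : a ≋ b → c ≋ d → a ⊖ c ≋ b ⊖ d
  ⊖-cong (a≼b , b≼a) (c≼d , d≼c) =
    ≼-trans (⊖-monoˡ a≼b) (⊖-antitoneʳ d≼c) , ≼-trans (⊖-monoˡ b≼a) (⊖-antitoneʳ c≼d)

  neg-cong : a ≋ b → neg a ≋ neg b
  neg-cong (a≼b , b≼a) = neg-antitone b≼a , neg-antitone a≼b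

  hlf-cong : a ≋ b → hlf a ≋ hlf b
  hlf-cong (a≼b , b≼a) = hlf-mono a≼b , hlf-mono b≼a

  maximalConsistent⇒closed : MaximalConsistent Γ → Γ ⊢ a → Γ a
  maximalConsistent⇒closed (_ , closed , _) ⊢a = closed _ (λ _ → provable-≼ ⊢a)

module Variables (R : Reals) (L : Signature R) where
  open Syntax R L
  open import Data.Nat using (_≤_; _<_; _⊔_; s≤s)
  open import Data.Nat.Properties
    using (≤-refl; ≤-trans; <⇒≤; <-≤-trans; <⇒≢; >⇒≢; n≤1+n; m⊔n≤o⇒m≤o; m⊔n≤o⇒n≤o)

  mutual
    AllVarsᵗ : Pred Var 0ℓ → Term → Set
    AllVarsᵗ P (var v)    = P v
    AllVarsᵗ P (app f ts) = AllVarsᵗˢ P ts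

    AllVarsᵗˢ : ∀ {n} → Pred Var 0ℓ → Vec Term n → Set
    AllVarsᵗˢ P []       = ⊤
    AllVarsᵗˢ P (s ∷ ss) = AllVarsᵗ P s × AllVarsᵗˢ P ss

  AllVars : Pred Var 0ℓ → Formula → Set
  AllVars P (rel Q ts) = AllVarsᵗˢ P ts
  AllVars P (a ⊖ b)    = AllVars P a × AllVars P b
  AllVars P (neg a)    = AllVars P a
  AllVars P (hlf a)    = AllVars P a
  AllVars P (supᶠ y a) = P y × AllVars P a

  BoundFrom : ℕ → Formula → Set
  BoundFrom m (rel Q ts) = ⊤
  BoundFrom m (a ⊖ b)    = BoundFrom m a × BoundFrom m b
  BoundFrom m (neg a)    = BoundFrom m a
  BoundFrom m (hlf a)    = BoundFrom m a
  BoundFrom m (supᶠ y a) = m ≤ y × BoundFrom m a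

  private variable
    P Q : Pred Var 0ℓ
    m n : ℕ

  mutual
    AllVarsᵗ-mono : P ⊆ Q → ∀ s → AllVarsᵗ P s → AllVarsᵗ Q s
    AllVarsᵗ-mono P⊆Q (var v)    Pv = P⊆Q Pv
    AllVarsᵗ-mono P⊆Q (app f ts) P∀ = AllVarsᵗˢ-mono P⊆Q ts P∀

    AllVarsᵗˢ-mono : P ⊆ Q → (ss : Vec Term n) → AllVarsᵗˢ P ss → AllVarsᵗˢ Q ss
    AllVarsᵗˢ-mono P⊆Q []       _           = tt
    AllVarsᵗˢ-mono P⊆Q (s ∷ ss) (Ps , Pss) = AllVarsᵗ-mono P⊆Q s Ps , AllVarsᵗˢ-mono P⊆Q ss Pss

  AllVars-mono : P ⊆ Q → ∀ ψ → AllVars P ψ → AllVars Q ψ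
  AllVars-mono P⊆Q (rel _ ts) P∀        = AllVarsᵗˢ-mono P⊆Q ts P∀
  AllVars-mono P⊆Q (a ⊖ b)    (Pa , Pb) = AllVars-mono P⊆Q a Pa , AllVars-mono P⊆Q b Pb
  AllVars-mono P⊆Q (neg a)    Pa        = AllVars-mono P⊆Q a Pa
  AllVars-mono P⊆Q (hlf a)    Pa        = AllVars-mono P⊆Q a Pa
  AllVars-mono P⊆Q (supᶠ y a) (Py , Pa) = P⊆Q Py , AllVars-mono P⊆Q a Pa

  mutual
    AllVarsᵗ-∈ : ∀ {v} s → v ∈T s → AllVarsᵗ P s → P v
    AllVarsᵗ-∈ (var v)    here       Pv = Pv
    AllVarsᵗ-∈ (app f ts) (inApp v∈) P∀ = AllVarsᵗˢ-∈ ts v∈ P∀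

    AllVarsᵗˢ-∈ : ∀ {v} (ss : Vec Term n) → Any (v ∈T_) ss → AllVarsᵗˢ P ss → P v
    AllVarsᵗˢ-∈ (s ∷ ss) (here v∈)  (Ps , _)  = AllVarsᵗ-∈ s v∈ Ps
    AllVarsᵗˢ-∈ (s ∷ ss) (there v∈) (_ , Pss) = AllVarsᵗˢ-∈ ss v∈ Pss

  AllVars-FreeIn : ∀ {v} ψ → FreeIn v ψ → AllVars P ψ → P v
  AllVars-FreeIn (rel _ ts) (inRel v∈)   P∀       = AllVarsᵗˢ-∈ ts v∈ P∀
  AllVars-FreeIn (a ⊖ b)    (inL v∈)     (Pa , _) = AllVars-FreeIn a v∈ Pa
  AllVars-FreeIn (a ⊖ b)    (inR v∈)     (_ , Pb) = AllVars-FreeIn b v∈ Pb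
  AllVars-FreeIn (neg a)    (inNeg v∈)   Pa       = AllVars-FreeIn a v∈ Pa
  AllVars-FreeIn (hlf a)    (inHlf v∈)   Pa       = AllVars-FreeIn a v∈ Pa
  AllVars-FreeIn (supᶠ y a) (inSup _ v∈) (_ , Pa) = AllVars-FreeIn a v∈ Pa

  mutual
    AllVarsᵗ-substT : ∀ t y s → AllVarsᵗ P t → AllVarsᵗ P s → AllVarsᵗ P (substT t y s)
    AllVarsᵗ-substT t y (var v) Pt Pv with y ≟ℕ v
    ... | yes _ = Pt
    ... | no  _ = Pv
    AllVarsᵗ-substT t y (app f ts) Pt P∀ = AllVarsᵗˢ-substT t y ts Pt P∀

    AllVarsᵗˢ-substT : ∀ t y (ss : Vec Term n) → AllVarsᵗ P t → AllVarsᵗˢ P ss → AllVarsᵗˢ P (substTs t y ss)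
    AllVarsᵗˢ-substT t y []       Pt _          = tt
    AllVarsᵗˢ-substT t y (s ∷ ss) Pt (Ps , Pss) = AllVarsᵗ-substT t y s Pt Ps , AllVarsᵗˢ-substT t y ss Pt Pss

  AllVars-[/] : ∀ t y ψ → AllVarsᵗ P t → AllVars P ψ → AllVars P (ψ [ t / y ])
  AllVars-[/] t y (rel _ ts) Pt P∀        = AllVarsᵗˢ-substT t y ts Pt P∀
  AllVars-[/] t y (a ⊖ b)    Pt (Pa , Pb) = AllVars-[/] t y a Pt Pa , AllVars-[/] t y b Pt Pb
  AllVars-[/] t y (neg a)    Pt Pa        = AllVars-[/] t y a Pt Pa
  AllVars-[/] t y (hlf a)    Pt Pa        = AllVars-[/] t y a Pt Pa
  AllVars-[/] t y (supᶠ w a) Pt (Pw , Pa) with y ≟ℕ w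
  ... | yes _ = Pw , Pa
  ... | no  _ = Pw , AllVars-[/] t y a Pt Pa

  BoundFrom-[/] : ∀ t y ψ → BoundFrom m ψ → BoundFrom m (ψ [ t / y ])
  BoundFrom-[/] t y (rel _ _)  _           = tt
  BoundFrom-[/] t y (a ⊖ b)    (Ba , Bb)   = BoundFrom-[/] t y a Ba , BoundFrom-[/] t y b Bb
  BoundFrom-[/] t y (neg a)    Ba          = BoundFrom-[/] t y a Ba
  BoundFrom-[/] t y (hlf a)    Ba          = BoundFrom-[/] t y a Ba
  BoundFrom-[/] t y (supᶠ w a) (m≤w , Ba) with y ≟ℕ w
  ... | yes _ = m≤w , Ba
  ... | no  _ = m≤w , BoundFrom-[/] t y a Ba

  BoundFrom-weaken : m ≤ n → ∀ ψ → BoundFrom n ψ → BoundFrom m ψ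
  BoundFrom-weaken m≤n (rel _ _)  _          = tt
  BoundFrom-weaken m≤n (a ⊖ b)    (Ba , Bb)  = BoundFrom-weaken m≤n a Ba , BoundFrom-weaken m≤n b Bb
  BoundFrom-weaken m≤n (neg a)    Ba         = BoundFrom-weaken m≤n a Ba
  BoundFrom-weaken m≤n (hlf a)    Ba         = BoundFrom-weaken m≤n a Ba
  BoundFrom-weaken m≤n (supᶠ w a) (n≤w , Ba) = ≤-trans m≤n n≤w , BoundFrom-weaken m≤n a Ba

  BoundFrom⇒SubstOK : ∀ t x ψ → BoundFrom m ψ → AllVarsᵗ (_< m) t → SubstOK t x ψ
  BoundFrom⇒SubstOK t x (rel _ _)  _          t<m = tt
  BoundFrom⇒SubstOK t x (a ⊖ b)    (Ba , Bb)  t<m = BoundFrom⇒SubstOK t x a Ba t<m , BoundFrom⇒SubstOK t x b Bb t<m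
  BoundFrom⇒SubstOK t x (neg a)    Ba         t<m = BoundFrom⇒SubstOK t x a Ba t<m
  BoundFrom⇒SubstOK t x (hlf a)    Ba         t<m = BoundFrom⇒SubstOK t x a Ba t<m
  BoundFrom⇒SubstOK t x (supᶠ y a) (m≤y , Ba) t<m =
    inj₂ (inj₂ ((λ y∈t → <⇒≢ (<-≤-trans (AllVarsᵗ-∈ t y∈t t<m) m≤y) refl) , BoundFrom⇒SubstOK t x a Ba t<m))

  mutual
    substT-absent : ∀ t y s → AllVarsᵗ (_≢ y) s → substT t y s ≡ s
    substT-absent t y (var v) v≢y with y ≟ℕ v
    ... | yes y≡v = ⊥-elim (v≢y (sym y≡v))
    ... | no  _   = refl
    substT-absent t y (app f ts) ≢y = cong (app f) (substTs-absent t y ts ≢y)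

    substTs-absent : ∀ t y (ss : Vec Term n) → AllVarsᵗˢ (_≢ y) ss → substTs t y ss ≡ ss
    substTs-absent t y []       _            = refl
    substTs-absent t y (s ∷ ss) (≢y , ≢y′) = cong₂ _∷_ (substT-absent t y s ≢y) (substTs-absent t y ss ≢y′)

  [/]-absent : ∀ t y ψ → AllVars (_≢ y) ψ → ψ [ t / y ] ≡ ψ
  [/]-absent t y (rel P ts) ≢y          = cong (rel P) (substTs-absent t y ts ≢y)
  [/]-absent t y (a ⊖ b)    (≢ya , ≢yb) = cong₂ _⊖_ ([/]-absent t y a ≢ya) ([/]-absent t y b ≢yb)
  [/]-absent t y (neg a)    ≢y          = cong neg ([/]-absent t y a ≢y)
  [/]-absent t y (hlf a)    ≢y          = cong hlf ([/]-absent t y a ≢y)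
  [/]-absent t y (supᶠ w a) (w≢y , ≢y) with y ≟ℕ w
  ... | yes y≡w = ⊥-elim (w≢y (sym y≡w))
  ... | no  _   = cong (supᶠ w) ([/]-absent t y a ≢y)

  mutual
    substT-rename-back : ∀ k y s → AllVarsᵗ (_≢ k) s → substT (var y) k (substT (var k) y s) ≡ s
    substT-rename-back k y (var v) v≢k with y ≟ℕ v
    ... | yes y≡v with k ≟ℕ k
    ...   | yes _   = cong var y≡v
    ...   | no  k≢k = ⊥-elim (k≢k refl)
    substT-rename-back k y (var v) v≢k | no _ with k ≟ℕ v
    ...   | yes k≡v = ⊥-elim (v≢k (sym k≡v))
    ...   | no  _   = refl
    substT-rename-back k y (app f ts) ≢k = cong (app f) (substTs-rename-back k y ts ≢k)

    substTs-rename-back : ∀ k y (ss : Vec Term n) → AllVarsᵗˢ (_≢ k) ss →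
                          substTs (var y) k (substTs (var k) y ss) ≡ ss
    substTs-rename-back k y []       _            = refl
    substTs-rename-back k y (s ∷ ss) (≢k , ≢k′) = cong₂ _∷_ (substT-rename-back k y s ≢k) (substTs-rename-back k y ss ≢k′)

  [/]-rename-back : ∀ k y ψ → AllVars (_≢ k) ψ → (ψ [ var k / y ]) [ var y / k ] ≡ ψ
  [/]-rename-back k y (rel P ts) ≢k          = cong (rel P) (substTs-rename-back k y ts ≢k)
  [/]-rename-back k y (a ⊖ b)    (≢ka , ≢kb) = cong₂ _⊖_ ([/]-rename-back k y a ≢ka) ([/]-rename-back k y b ≢kb)
  [/]-rename-back k y (neg a)    ≢k          = cong neg ([/]-rename-back k y a ≢k)
  [/]-rename-back k y (hlf a)    ≢k          = cong hlf ([/]-rename-back k y a ≢k)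
  [/]-rename-back k y (supᶠ w a) (w≢k , ≢k) with y ≟ℕ w
  ... | yes _ with k ≟ℕ w
  ...   | yes k≡w = ⊥-elim (w≢k (sym k≡w))
  ...   | no  _   = cong (supᶠ w) ([/]-absent (var y) k a ≢k)
  [/]-rename-back k y (supᶠ w a) (w≢k , ≢k) | no _ with k ≟ℕ w
  ...   | yes k≡w = ⊥-elim (w≢k (sym k≡w))
  ...   | no  _   = cong (supᶠ w) ([/]-rename-back k y a ≢k)

  mutual
    ∉-substT : ∀ {t y} s → ¬ y ∈T t → ¬ y ∈T substT t y s
    ∉-substT {t} {y} (var v) y∉t y∈ with y ≟ℕ v
    ∉-substT (var v) y∉t y∈   | yes _ = y∉t y∈
    ∉-substT (var v) y∉t here | no  y≢y = y≢y refl
    ∉-substT (app f ts) y∉t (inApp y∈) = ∉-substTs ts y∉t y∈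

    ∉-substTs : ∀ {t y} (ss : Vec Term n) → ¬ y ∈T t → ¬ Any (y ∈T_) (substTs t y ss)
    ∉-substTs (s ∷ ss) y∉t (here y∈)  = ∉-substT s y∉t y∈
    ∉-substTs (s ∷ ss) y∉t (there y∈) = ∉-substTs ss y∉t y∈

  ¬FreeIn-[/] : ∀ {t y} ψ → ¬ y ∈T t → ¬ FreeIn y (ψ [ t / y ])
  ¬FreeIn-[/] (rel P ts) y∉t (inRel y∈) = ∉-substTs ts y∉t y∈
  ¬FreeIn-[/] (a ⊖ b)    y∉t (inL y∈)   = ¬FreeIn-[/] a y∉t y∈
  ¬FreeIn-[/] (a ⊖ b)    y∉t (inR y∈)   = ¬FreeIn-[/] b y∉t y∈
  ¬FreeIn-[/] (neg a)    y∉t (inNeg y∈) = ¬FreeIn-[/] a y∉t y∈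
  ¬FreeIn-[/] (hlf a)    y∉t (inHlf y∈) = ¬FreeIn-[/] a y∉t y∈
  ¬FreeIn-[/] {y = y} (supᶠ w a) y∉t y∈ with y ≟ℕ w
  ¬FreeIn-[/] (supᶠ w a) y∉t (inSup y≢w _)  | yes y≡w = y≢w y≡w
  ¬FreeIn-[/] (supᶠ w a) y∉t (inSup _   y∈) | no  _   = ¬FreeIn-[/] a y∉t y∈

  renameBound : ℕ → Formula → Formula
  renameBound k (rel P ts) = rel P ts
  renameBound k (a ⊖ b)    = renameBound k a ⊖ renameBound k b
  renameBound k (neg a)    = neg (renameBound k a)
  renameBound k (hlf a)    = hlf (renameBound k a)
  renameBound k (supᶠ y a) = supᶠ k (renameBound (suc k) a [ var k / y ])

  renameBound-BoundFrom : ∀ k ψ → BoundFrom k (renameBound k ψ)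
  renameBound-BoundFrom k (rel _ _)  = tt
  renameBound-BoundFrom k (a ⊖ b)    = renameBound-BoundFrom k a , renameBound-BoundFrom k b
  renameBound-BoundFrom k (neg a)    = renameBound-BoundFrom k a
  renameBound-BoundFrom k (hlf a)    = renameBound-BoundFrom k a
  renameBound-BoundFrom k (supᶠ y a) =
    ≤-refl , BoundFrom-weaken (n≤1+n k) (renameBound (suc k) a [ var k / y ])
                (BoundFrom-[/] (var k) y (renameBound (suc k) a) (renameBound-BoundFrom (suc k) a))

  renameBound-AllVars : ∀ k ψ → (∀ {v} → k ≤ v → P v) → AllVars P ψ → AllVars P (renameBound k ψ)
  renameBound-AllVars k (rel _ _)  P≥k P∀        = P∀
  renameBound-AllVars k (a ⊖ b)    P≥k (Pa , Pb) = renameBound-AllVars k a P≥k Pa , renameBound-AllVars k b P≥k Pb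
  renameBound-AllVars k (neg a)    P≥k Pa        = renameBound-AllVars k a P≥k Pa
  renameBound-AllVars k (hlf a)    P≥k Pa        = renameBound-AllVars k a P≥k Pa
  renameBound-AllVars k (supᶠ y a) P≥k (_ , Pa)  =
    P≥k ≤-refl , AllVars-[/] (var k) y (renameBound (suc k) a) (P≥k ≤-refl)
                  (renameBound-AllVars (suc k) a (λ k<v → P≥k (<⇒≤ k<v)) Pa)

  renameBound-fresh : ∀ {k} ψ → AllVars (_< k) ψ → AllVars (_≢ k) (renameBound (suc k) ψ)
  renameBound-fresh {k} ψ ψ<k = renameBound-AllVars (suc k) ψ >⇒≢ (AllVars-mono <⇒≢ ψ ψ<k)

  mutual
    maxVarᵗ : Term → ℕ
    maxVarᵗ (var v)    = v
    maxVarᵗ (app f ts) = maxVarᵗˢ ts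

    maxVarᵗˢ : Vec Term n → ℕ
    maxVarᵗˢ []       = 0
    maxVarᵗˢ (s ∷ ss) = maxVarᵗ s ⊔ maxVarᵗˢ ss

  maxVar : Formula → ℕ
  maxVar (rel P ts) = maxVarᵗˢ ts
  maxVar (a ⊖ b)    = maxVar a ⊔ maxVar b
  maxVar (neg a)    = maxVar a
  maxVar (hlf a)    = maxVar a
  maxVar (supᶠ y a) = y ⊔ maxVar a

  mutual
    maxVarᵗ-bound : ∀ s → maxVarᵗ s ≤ n → AllVarsᵗ (_< suc n) s
    maxVarᵗ-bound (var v)    v≤n = s≤s v≤n
    maxVarᵗ-bound (app f ts) ≤n  = maxVarᵗˢ-bound ts ≤n

    maxVarᵗˢ-bound : (ss : Vec Term m) → maxVarᵗˢ ss ≤ n → AllVarsᵗˢ (_< suc n) ss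
    maxVarᵗˢ-bound []       _  = tt
    maxVarᵗˢ-bound (s ∷ ss) ≤n = maxVarᵗ-bound s (m⊔n≤o⇒m≤o _ _ ≤n) , maxVarᵗˢ-bound ss (m⊔n≤o⇒n≤o _ _ ≤n)

  maxVar-bound : ∀ ψ → maxVar ψ ≤ n → AllVars (_< suc n) ψ
  maxVar-bound (rel _ ts) ≤n = maxVarᵗˢ-bound ts ≤n
  maxVar-bound (a ⊖ b)    ≤n = maxVar-bound a (m⊔n≤o⇒m≤o _ _ ≤n) , maxVar-bound b (m⊔n≤o⇒n≤o _ _ ≤n)
  maxVar-bound (neg a)    ≤n = maxVar-bound a ≤n
  maxVar-bound (hlf a)    ≤n = maxVar-bound a ≤n
  maxVar-bound (supᶠ y a) ≤n = s≤s (m⊔n≤o⇒m≤o _ _ ≤n) , maxVar-bound a (m⊔n≤o⇒n≤o _ _ ≤n)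

module AlphaConversion (R : Reals) (L : Signature R) where
  open Syntax R L
  open Variables R L
  open import Data.Nat using (_<_)
  open import Data.Nat.Properties using (<⇒≢; n<1+n; m<n⇒m<1+n)

  ∅ : FSet
  ∅ _ = ⊥

  open Łukasiewicz R L ∅

  ∅⊢-gen : ∀ y {φ} → ∅ ⊢ φ → ∅ ⊢ supᶠ y φ
  ∅⊢-gen y (axiom ax)  = axiom (gen y ax)
  ∅⊢-gen y (mp ⊢φ ⊢ψ∸φ) = mp (∅⊢-gen y ⊢φ) (mp (∅⊢-gen y ⊢ψ∸φ) (axiom (A7 y _ _)))

  ∅⊢-weaken : ∀ {Δ φ} → ∅ ⊢ φ → Δ ⊢ φ
  ∅⊢-weaken (axiom ax)  = axiom ax
  ∅⊢-weaken (mp ⊢φ ⊢ψ∸φ) = mp (∅⊢-weaken ⊢φ) (∅⊢-weaken ⊢ψ∸φ)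

  supᶠ-mono : ∀ y {a b} → a ≼ b → supᶠ y a ≼ supᶠ y b
  supᶠ-mono y a≼b = mp (∅⊢-gen y a≼b) (axiom (A7 y _ _))

  supᶠ-cong : ∀ y {a b} → a ≋ b → supᶠ y a ≋ supᶠ y b
  supᶠ-cong y (a≼b , b≼a) = supᶠ-mono y a≼b , supᶠ-mono y b≼a

  supᶠ-α : ∀ {m k y} a → BoundFrom m a → k < m → y < m → y ≢ k → AllVars (_≢ k) a →
           supᶠ k (a [ var k / y ]) ≋ supᶠ y a
  supᶠ-α {k = k} {y} a a≥m k<m y<m y≢k a∌k =
      ≼-trans (supᶠ-mono k (axiom (A8 y (var k) a k-free-for-y))) (axiom (A9 k (supᶠ y a) k∉))
    , ≼-trans (supᶠ-mono y a≼sup) (axiom (A9 y (supᶠ k a[k/y]) y∉))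
    where
      a[k/y] : Formula
      a[k/y] = a [ var k / y ]
      k-free-for-y : SubstOK (var k) y a
      k-free-for-y = BoundFrom⇒SubstOK (var k) y a a≥m k<m
      y-free-for-k : SubstOK (var y) k a[k/y]
      y-free-for-k = BoundFrom⇒SubstOK (var y) k a[k/y] (BoundFrom-[/] (var k) y a a≥m) y<m
      a≼sup : a ≼ supᶠ k a[k/y]
      a≼sup = subst (_≼ supᶠ k a[k/y]) ([/]-rename-back k y a a∌k) (axiom (A8 k (var y) a[k/y] y-free-for-k))
      k∉ : ¬ FreeIn k (supᶠ y a)
      k∉ (inSup _ k∈a) = AllVars-FreeIn a k∈a a∌k refl
      y∉ : ¬ FreeIn y (supᶠ k a[k/y])
      y∉ (inSup _ y∈) = ¬FreeIn-[/] a (λ { here → y≢k refl }) y∈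

  renameBound-≋ : ∀ {k} ψ → AllVars (_< k) ψ → renameBound k ψ ≋ ψ
  renameBound-≋ (rel _ _)  _            = ≼-refl , ≼-refl
  renameBound-≋ (a ⊖ b)    (a<k , b<k)  = ⊖-cong (renameBound-≋ a a<k) (renameBound-≋ b b<k)
  renameBound-≋ (neg a)    a<k          = neg-cong (renameBound-≋ a a<k)
  renameBound-≋ (hlf a)    a<k          = hlf-cong (renameBound-≋ a a<k)
  renameBound-≋ {k} (supᶠ y a) (y<k , a<k) =
    ≋-trans (supᶠ-α (renameBound (suc k) a) (renameBound-BoundFrom (suc k) a) (n<1+n k) (m<n⇒m<1+n y<k) (<⇒≢ y<k)
                    (renameBound-fresh a a<k))
            (supᶠ-cong y (renameBound-≋ a (AllVars-mono m<n⇒m<1+n a a<k)))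

  renameBound-instance : ∀ {k} ψ t x → AllVars (_< k) ψ → AllVarsᵗ (_< k) t →
                         renameBound k ψ [ t / x ] ≼ supᶠ x ψ
  renameBound-instance {k} ψ t x ψ<k t<k =
    ≼-trans (axiom (A8 x t (renameBound k ψ) (BoundFrom⇒SubstOK t x (renameBound k ψ) (renameBound-BoundFrom k ψ) t<k)))
            (supᶠ-mono x (proj₁ (renameBound-≋ ψ ψ<k)))

module Semantics (R : Reals) (L : Signature R) (𝔐 : Syntax.PreStructure R L) where
  open Reals R
  open RealOps R using (_-_; _∸ℝ_)
  open RealFacts R
  open Syntax R L
  open PreStructure 𝔐
  open Variables R L
  open import Data.Nat using (_<_)
  open import Data.Nat.Properties using (>⇒≢; <-≤-trans; n<1+n; m<n⇒m<1+n)

  private variable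
    n : ℕ

  eval-unit : ∀ σ ψ → InUnit (eval 𝔐 σ ψ)
  eval-unit σ (rel P ts) = relI-range P _
  eval-unit σ (a ⊖ b)    = ∸ℝ-unit (eval-unit σ a) (eval-unit σ b)
  eval-unit σ (neg a)    = 1-‿unit (eval-unit σ a)
  eval-unit σ (hlf a)    = ½*-unit (eval-unit σ a)
  eval-unit σ (supᶠ y a) = sup-unit _ inhabited (λ c → eval-unit (update 𝔐 σ y c) a)

  eval-supᶠ-cong : ∀ σ τ y z a b → (∀ c → eval 𝔐 (update 𝔐 σ y c) a ≡ eval 𝔐 (update 𝔐 τ z c) b) →
                   eval 𝔐 σ (supᶠ y a) ≡ eval 𝔐 τ (supᶠ z b)
  eval-supᶠ-cong σ τ y z a b = sup-cong 1ℝ inhabited (λ c → proj₂ (eval-unit (update 𝔐 σ y c) a))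

  update-≡ : ∀ σ {x} c {v} → x ≡ v → update 𝔐 σ x c v ≡ c
  update-≡ σ {x} c refl with x ≟ℕ x
  ... | yes _   = refl
  ... | no  x≢x = ⊥-elim (x≢x refl)

  update-≢ : ∀ σ {x} c {v} → x ≢ v → update 𝔐 σ x c v ≡ σ v
  update-≢ σ {x} c {v} x≢v with x ≟ℕ v
  ... | yes x≡v = ⊥-elim (x≢v x≡v)
  ... | no  _   = refl

  update-cong : ∀ {σ τ} x c v → (x ≢ v → σ v ≡ τ v) → update 𝔐 σ x c v ≡ update 𝔐 τ x c v
  update-cong x c v σ≡τ with x ≟ℕ v
  ... | yes _   = refl
  ... | no  x≢v = σ≡τ x≢v

  update-comm : ∀ σ {x y} c e v → x ≢ y →
                update 𝔐 (update 𝔐 σ x c) y e v ≡ update 𝔐 (update 𝔐 σ y e) x c v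
  update-comm σ {x} {y} c e v x≢y with x ≟ℕ v | y ≟ℕ v
  ... | yes x≡v | yes y≡v = ⊥-elim (x≢y (trans x≡v (sym y≡v)))
  ... | yes x≡v | no  _   = update-≡ σ c x≡v
  ... | no  _   | yes y≡v = sym (update-≡ σ e y≡v)
  ... | no  x≢v | no  y≢v = trans (update-≢ σ c x≢v) (sym (update-≢ σ e y≢v))


  mutual
    evalᵗ-coincidence : ∀ {σ τ} s → (∀ {v} → v ∈T s → σ v ≡ τ v) → evalT 𝔐 σ s ≡ evalT 𝔐 τ s
    evalᵗ-coincidence (var v)    σ≡τ = σ≡τ here
    evalᵗ-coincidence (app f ts) σ≡τ = cong (funI f) (evalᵗˢ-coincidence ts (λ v∈ → σ≡τ (inApp v∈)))

    evalᵗˢ-coincidence : ∀ {σ τ} (ss : Vec Term n) → (∀ {v} → Any (v ∈T_) ss → σ v ≡ τ v) →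
                         evalTs 𝔐 σ ss ≡ evalTs 𝔐 τ ss
    evalᵗˢ-coincidence []       σ≡τ = refl
    evalᵗˢ-coincidence (s ∷ ss) σ≡τ =
      cong₂ _∷_ (evalᵗ-coincidence s (λ v∈ → σ≡τ (here v∈))) (evalᵗˢ-coincidence ss (λ v∈ → σ≡τ (there v∈)))

  eval-coincidence : ∀ {σ τ} ψ → (∀ {v} → FreeIn v ψ → σ v ≡ τ v) → eval 𝔐 σ ψ ≡ eval 𝔐 τ ψ
  eval-coincidence (rel P ts) σ≡τ = cong (relI P) (evalᵗˢ-coincidence ts (λ v∈ → σ≡τ (inRel v∈)))
  eval-coincidence (a ⊖ b)    σ≡τ =
    cong₂ _∸ℝ_ (eval-coincidence a (λ v∈ → σ≡τ (inL v∈))) (eval-coincidence b (λ v∈ → σ≡τ (inR v∈)))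
  eval-coincidence (neg a)    σ≡τ = cong (λ r → 1ℝ - r) (eval-coincidence a (λ v∈ → σ≡τ (inNeg v∈)))
  eval-coincidence (hlf a)    σ≡τ = cong (½ *_) (eval-coincidence a (λ v∈ → σ≡τ (inHlf v∈)))
  eval-coincidence {σ} {τ} (supᶠ y a) σ≡τ = eval-supᶠ-cong σ τ y y a a λ c →
    eval-coincidence a (λ {v} v∈a → update-cong y c v (λ y≢v → σ≡τ (inSup (≢-sym y≢v) v∈a)))

  mutual
    evalᵗ-substT : ∀ τ t y s → evalT 𝔐 τ (substT t y s) ≡ evalT 𝔐 (update 𝔐 τ y (evalT 𝔐 τ t)) s
    evalᵗ-substT τ t y (var v) with y ≟ℕ v
    ... | yes _ = refl
    ... | no  _ = refl
    evalᵗ-substT τ t y (app f ts) = cong (funI f) (evalᵗˢ-substT τ t y ts)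

    evalᵗˢ-substT : ∀ τ t y (ss : Vec Term n) →
                    evalTs 𝔐 τ (substTs t y ss) ≡ evalTs 𝔐 (update 𝔐 τ y (evalT 𝔐 τ t)) ss
    evalᵗˢ-substT τ t y []       = refl
    evalᵗˢ-substT τ t y (s ∷ ss) = cong₂ _∷_ (evalᵗ-substT τ t y s) (evalᵗˢ-substT τ t y ss)

  eval-[/] : ∀ {m} τ t y ψ → BoundFrom m ψ → AllVarsᵗ (_< m) t →
             eval 𝔐 τ (ψ [ t / y ]) ≡ eval 𝔐 (update 𝔐 τ y (evalT 𝔐 τ t)) ψ
  eval-[/] τ t y (rel P ts) _          t<m = cong (relI P) (evalᵗˢ-substT τ t y ts)
  eval-[/] τ t y (a ⊖ b)    (a≥m , b≥m) t<m = cong₂ _∸ℝ_ (eval-[/] τ t y a a≥m t<m) (eval-[/] τ t y b b≥m t<m)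
  eval-[/] τ t y (neg a)    a≥m        t<m = cong (λ r → 1ℝ - r) (eval-[/] τ t y a a≥m t<m)
  eval-[/] τ t y (hlf a)    a≥m        t<m = cong (½ *_) (eval-[/] τ t y a a≥m t<m)
  eval-[/] τ t y (supᶠ w a) (m≤w , a≥m) t<m with y ≟ℕ w
  ... | yes y≡w = eval-coincidence (supᶠ w a)
                    (λ { (inSup v≢w _) → sym (update-≢ τ _ (λ y≡v → v≢w (trans (sym y≡v) y≡w))) })
  ... | no  y≢w = eval-supᶠ-cong τ (update 𝔐 τ y (evalT 𝔐 τ t)) w w (a [ t / y ]) a λ c →
                    trans (eval-[/] (update 𝔐 τ w c) t y a a≥m t<m) (eval-coincidence a (λ {v} _ → swap c v))
    where
      t-unaffected : ∀ c → evalT 𝔐 (update 𝔐 τ w c) t ≡ evalT 𝔐 τ t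
      t-unaffected c = evalᵗ-coincidence t (λ v∈t → update-≢ τ c (>⇒≢ (<-≤-trans (AllVarsᵗ-∈ t v∈t t<m) m≤w)))
      swap : ∀ c v → update 𝔐 (update 𝔐 τ w c) y (evalT 𝔐 (update 𝔐 τ w c) t) v
                     ≡ update 𝔐 (update 𝔐 τ y (evalT 𝔐 τ t)) w c v
      swap c v = trans (cong (λ e → update 𝔐 (update 𝔐 τ w c) y e v) (t-unaffected c))
                       (update-comm τ c _ v (≢-sym y≢w))

  eval-supᶠ-α : ∀ {m} σ k y a → BoundFrom m a → k < m → ¬ FreeIn k (supᶠ y a) →
                eval 𝔐 σ (supᶠ k (a [ var k / y ])) ≡ eval 𝔐 σ (supᶠ y a)
  eval-supᶠ-α σ k y a a≥m k<m k∉ = eval-supᶠ-cong σ σ k y (a [ var k / y ]) a λ c →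
    trans (eval-[/] (update 𝔐 σ k c) (var k) y a a≥m k<m) (eval-coincidence a (λ {v} v∈a → agree c v v∈a))
    where
      agree : ∀ c v → FreeIn v a → update 𝔐 (update 𝔐 σ k c) y (update 𝔐 σ k c k) v ≡ update 𝔐 σ y c v
      agree c v v∈a = trans (cong (λ e → update 𝔐 (update 𝔐 σ k c) y e v) (update-≡ σ {k} c refl))
                            (update-cong y c v (λ y≢v → update-≢ σ {k} c (λ { refl → k∉ (inSup (≢-sym y≢v) v∈a) })))

  eval-renameBound : ∀ {k} σ ψ → AllVars (_< k) ψ → eval 𝔐 σ (renameBound k ψ) ≡ eval 𝔐 σ ψ
  eval-renameBound σ (rel _ _)  _           = refl
  eval-renameBound σ (a ⊖ b)    (a<k , b<k) = cong₂ _∸ℝ_ (eval-renameBound σ a a<k) (eval-renameBound σ b b<k)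
  eval-renameBound σ (neg a)    a<k         = cong (λ r → 1ℝ - r) (eval-renameBound σ a a<k)
  eval-renameBound σ (hlf a)    a<k         = cong (½ *_) (eval-renameBound σ a a<k)
  eval-renameBound {k} σ (supᶠ y a) (_ , a<k) =
    trans (eval-supᶠ-α σ k y a′ (renameBound-BoundFrom (suc k) a) (n<1+n k) k∉)
          (eval-supᶠ-cong σ σ y y a′ a (λ c → eval-renameBound (update 𝔐 σ y c) a (AllVars-mono m<n⇒m<1+n a a<k)))
    where
      a′ : Formula
      a′ = renameBound (suc k) a
      k∉ : ¬ FreeIn k (supᶠ y a′)
      k∉ (inSup _ k∈) = AllVars-FreeIn a′ k∈ (renameBound-fresh a a<k) refl

lemma8p11 : (R : Reals) (L : Signature R) →
    let open Syntax R L in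
    (Γ Δ : FSet) → MaximalConsistent Δ → (∀ φ → Γ φ → Δ φ) →
    (t : Term) (x : Var) (φ p : Formula) → IsDyadic p →
    Δ (supᶠ x φ ⊖ p) →
    Σ Formula (λ φ′ → SemEquiv φ φ′ × Δ ((φ′ [ t / x ]) ⊖ p))
lemma8p11 R L Γ Δ Δ-max _ t x φ p _ sup∸p∈Δ = φ′ , φ≡φ′ , maximalConsistent⇒closed Δ-max ⊢φ′[t/x]∸p
  where
    open Syntax R L
    open Variables R L
    open AlphaConversion R L using (∅⊢-weaken; renameBound-instance)
    open Łukasiewicz R L Δ using (≼-trans; maximalConsistent⇒closed)
    open import Data.Nat using (_<_; _⊔_)
    open import Data.Nat.Properties using (m≤m⊔n; m≤n⊔m)

    k : ℕ
    k = suc (maxVar φ ⊔ maxVarᵗ t)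
    φ<k : AllVars (_< k) φ
    φ<k = maxVar-bound φ (m≤m⊔n _ _)
    t<k : AllVarsᵗ (_< k) t
    t<k = maxVarᵗ-bound t (m≤n⊔m _ _)

    φ′ : Formula
    φ′ = renameBound k φ
    φ≡φ′ : SemEquiv φ φ′
    φ≡φ′ 𝔐 σ = sym (Semantics.eval-renameBound R L 𝔐 σ φ φ<k)
    ⊢φ′[t/x]∸p : Δ ⊢ (φ′ [ t / x ]) ⊖ p
    ⊢φ′[t/x]∸p = ≼-trans (∅⊢-weaken (renameBound-instance φ t x φ<k t<k)) (hyp sup∸p∈Δ)
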